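{- For $n\ge0$, let $\rho_{\epsilon}(n)$ denote the number of partitions of $n$ in which the largest part $r$ appears exactly once and the remaining parts form a partition of $r$ in which every even part is less than every odd part (for example, $\rho_\epsilon(10)=3$, the relevant partitions being $5+3+2$, $5+3+1+1$, $5+1+1+1+1+1$). Then, as formal power series (equivalently for $|q|<1$), $$\sum_{n=0}^{\infty}\rho_{\epsilon}(n)q^n=\frac{1}{1-q^2}\left[\frac{1}{(q^4;q^4)_\infty}-1\right].$$
   Context: For $|q|<1$, $(a;q)_\infty=\prod_{k=0}^{\infty}(1-aq^k)$. Since the largest part $r$ appears exactly once, all remaining parts are strictly smaller than $r$, and $n=2r$. The empty partition has no largest part, so $\rho_\epsilon(0)=0$. -}

module Defs where

open import Data.Nat as ℕ using (ℕ; zero; suc; _∸_; _≤_; _<_; _≥_)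
open import Data.Nat.Divisibility using (_∣_; _∣?_)
open import Data.Integer as ℤ using (ℤ; +_)
open import Data.List using (List; []; _∷_; length)
open import Data.Nat.ListAction using (sum)
open import Data.List.Relation.Unary.All using (All)
open import Data.List.Relation.Unary.Linked using (Linked)
open import Data.List.Relation.Unary.Unique.Propositional using (Unique)
open import Data.List.Membership.Propositional using (_∈_)
open import Data.Product using (Σ; ∃; _×_; ∃-syntax)
open import Function.Bundles using (_⇔_)
open import Relation.Nullary using (¬_; yes; no)
open import Relation.Binary.PropositionalEquality using (_≡_)

-- Formal power series with integer coefficients: n ↦ coefficient of q^n

Series : Set
Series = ℕ → ℤ

sumTo : ℕ → (ℕ → ℤ) → ℤ
sumTo zero    f = f zero
sumTo (suc n) f = sumTo n f ℤ.+ f (suc n)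

_⊛_ : Series → Series → Series
(f ⊛ g) n = sumTo n (λ i → f i ℤ.* g (n ∸ i))

_⊝_ : Series → Series → Series
(f ⊝ g) n = f n ℤ.- g n

one : Series
one zero    = + 1
one (suc n) = + 0

-- geom a = 1/(1-q^a) = Σ_{j≥0} q^{a j}   (used for a ≥ 1)
geom : ℕ → Series
geom a n with a ∣? n
... | yes _ = + 1
... | no  _ = + 0

prodTo : ℕ → (ℕ → Series) → Series
prodTo zero    F = one
prodTo (suc m) F = prodTo m F ⊛ F (suc m)

-- 1/(q^4;q^4)_∞ = Π_{k≥1} 1/(1-q^{4k}).  Factors with 4k > n are ≡ 1 mod q^{n+1},
-- so the coefficient of q^n of the infinite product is that of Π_{k=1}^{n}.
invQ4Q4 : Series
invQ4Q4 n = prodTo n (λ k → geom (4 ℕ.* k)) n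

rhs : Series
rhs = geom 2 ⊛ (invQ4Q4 ⊝ one)

IsPartition : ℕ → List ℕ → Set
IsPartition n λs = Linked _≥_ λs × All (1 ≤_) λs × sum λs ≡ n

Even Odd : ℕ → Set
Even x = 2 ∣ x
Odd x = ¬ (2 ∣ x)

EvensBelowOdds : List ℕ → Set
EvensBelowOdds xs = ∀ {x y} → x ∈ xs → y ∈ xs → Even x → Odd y → x < y

RhoPartition : ℕ → List ℕ → Set
RhoPartition n λs =
  IsPartition n λs ×
  ∃[ r ] ∃[ rest ] (λs ≡ r ∷ rest × All (_< r) rest × IsPartition r rest × EvensBelowOdds rest)

-- "the number of objects satisfying P is c": a duplicate-free list enumerating
-- exactly the objects satisfying P, of length c
CountIs : {A : Set} → (A → Set) → ℤ → Set
CountIs {A} P c = Σ (List A) λ L → Unique L × (∀ x → (x ∈ L) ⇔ P x) × (+ length L ≡ c)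

{-# OPTIONS --safe #-}

-- Deleting the largest part r of a partition counted by ρ_ε(n) leaves a partition of r,
-- other than (r) itself, whose even parts lie below its odd parts; in particular n = 2r.
-- Such a partition with b odd parts is encoded by the pair (b, ν) where ν lists the
-- nonzero halves ⌊x/2⌋ of its parts: its parts are 2ν₁+1, …, 2ν_b+1 (ν padded with
-- zeros) followed by 2ν_{b+1}, 2ν_{b+2}, ….  The pairs with b + 2|ν| = r are counted by
-- the coefficient of q^{2r} in 1/(1-q²) · 1/(q⁴;q⁴)_∞, and discarding the one pair that
-- decodes to (r) (to the empty partition when r = 0) subtracts 1/(1-q²).
module Submission where

open import Defs
open import Data.Bool using (Bool; true; false; if_then_else_)
open import Data.Empty using (⊥-elim)
open import Data.Integer as ℤ using (ℤ; +_)
import Data.Integer.Properties as ℤ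
open import Algebra.Properties.AbelianGroup ℤ.+-0-abelianGroup using (∙-cancelʳ)
open import Data.List using (List; []; _∷_; [_]; _++_; map; filter; length; drop)
open import Data.List.Membership.Propositional using (_∈_)
open import Data.List.Membership.Propositional.Properties
  using (∈-map⁺; ∈-map⁻; ∈-++⁺ˡ; ∈-++⁺ʳ; ∈-++⁻; ∈-filter⁺; ∈-filter⁻)
open import Data.List.Properties
  using ( length-++; length-map; ∷-injectiveʳ; filter-accept; filter-reject; filter-all
        ; map-∘; map-id-local)
open import Data.List.Relation.Unary.All as All using (All; []; _∷_)
open import Data.List.Relation.Unary.All.Properties using (all-filter)
open import Data.List.Relation.Unary.Any using (here; there)
open import Data.List.Relation.Unary.Linked as Linked using (Linked; []; [-]; _∷_)
import Data.List.Relation.Unary.Linked.Properties as Linked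
open import Data.List.Relation.Unary.Unique.Propositional using (Unique; []; _∷_)
import Data.List.Relation.Unary.Unique.Propositional.Properties as Unique
open import Data.Nat as ℕ
  using (ℕ; zero; suc; _+_; _*_; _∸_; _≤_; _<_; _≥_; z≤n; s≤s; _≤?_; ⌊_/2⌋; NonZero)
import Data.Nat.Properties as ℕ
open import Data.Nat.Divisibility using (_∣_; _∣?_; divides; ∣m+n∣m⇒∣n; ∣m∣n⇒∣m+n; ∣-refl; ∣⇒≤; ∣1⇒≡1)
open import Data.Nat.ListAction using (sum)
open import Data.Nat.Tactic.RingSolver using (solve-∀)
open import Data.Product using (∃; _×_; _,_; proj₁; proj₂)
open import Data.Sum using (_⊎_; inj₁; inj₂)
open import Function using (_∘_)
open import Function.Bundles using (mk⇔)
open import Relation.Nullary using (¬_; yes; no; Dec)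
open import Relation.Nullary.Decidable using (decidable-stable)
open import Relation.Unary using (Decidable)
open import Relation.Binary.PropositionalEquality hiding ([_])

-- Finite sums and power series

sumBelow : ℕ → (ℕ → ℤ) → ℤ
sumBelow zero    f = + 0
sumBelow (suc n) f = sumBelow n f ℤ.+ f n

sumTo≡sumBelow : ∀ n f → sumTo n f ≡ sumBelow (suc n) f
sumTo≡sumBelow zero    f = sym (ℤ.+-identityˡ (f 0))
sumTo≡sumBelow (suc n) f = cong (ℤ._+ f (suc n)) (sumTo≡sumBelow n f)

sumBelow-cong : ∀ n {f g} → (∀ i → i < n → f i ≡ g i) → sumBelow n f ≡ sumBelow n g
sumBelow-cong zero    eq = refl
sumBelow-cong (suc n) eq =
  cong₂ ℤ._+_ (sumBelow-cong n (λ i i<n → eq i (ℕ.m<n⇒m<1+n i<n))) (eq n ℕ.≤-refl)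

sumBelow-last : ∀ n {f} → (∀ i → i < n → f i ≡ + 0) → sumBelow (suc n) f ≡ f n
sumBelow-last n {f} vanish = begin
  sumBelow n f ℤ.+ f n           ≡⟨ cong (ℤ._+ f n) (sumBelow-cong n vanish) ⟩
  sumBelow n (λ _ → + 0) ℤ.+ f n ≡⟨ cong (ℤ._+ f n) (zeros n) ⟩
  + 0 ℤ.+ f n                    ≡⟨ ℤ.+-identityˡ (f n) ⟩
  f n                            ∎
  where
  open ≡-Reasoning
  zeros : ∀ n → sumBelow n (λ _ → + 0) ≡ + 0
  zeros zero    = refl
  zeros (suc n) = trans (ℤ.+-identityʳ _) (zeros n)

sumBelow-+ : ∀ m n f → sumBelow (m + n) f ≡ sumBelow m f ℤ.+ sumBelow n (λ i → f (m + i))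
sumBelow-+ m zero    f rewrite ℕ.+-identityʳ m = sym (ℤ.+-identityʳ _)
sumBelow-+ m (suc n) f rewrite ℕ.+-suc m n =
  trans (cong (ℤ._+ f (m + n)) (sumBelow-+ m n f)) (ℤ.+-assoc (sumBelow m f) _ _)

sumBelow-suc : ∀ n f → sumBelow (suc n) f ≡ f 0 ℤ.+ sumBelow n (λ i → f (suc i))
sumBelow-suc zero    f = trans (ℤ.+-identityˡ (f 0)) (sym (ℤ.+-identityʳ (f 0)))
sumBelow-suc (suc n) f =
  trans (cong (ℤ._+ f (suc n)) (sumBelow-suc n f)) (ℤ.+-assoc (f 0) _ _)

sumBelow-reverse : ∀ n f → sumBelow n f ≡ sumBelow n (λ i → f (n ∸ suc i))
sumBelow-reverse zero    f = refl
sumBelow-reverse (suc n) f = begin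
  sumBelow n f ℤ.+ f n                          ≡⟨ cong (ℤ._+ f n) (sumBelow-reverse n f) ⟩
  sumBelow n (λ i → f (n ∸ suc i)) ℤ.+ f n      ≡⟨ ℤ.+-comm _ (f n) ⟩
  f n ℤ.+ sumBelow n (λ i → f (n ∸ suc i))      ≡⟨ sym (sumBelow-suc n (λ i → f (n ∸ i))) ⟩
  sumBelow (suc n) (λ i → f (n ∸ i))            ∎
  where open ≡-Reasoning

⊛-comm : ∀ f g n → (f ⊛ g) n ≡ (g ⊛ f) n
⊛-comm f g n = begin
  sumTo n (λ i → f i ℤ.* g (n ∸ i))                        ≡⟨ sumTo≡sumBelow n _ ⟩
  sumBelow (suc n) (λ i → f i ℤ.* g (n ∸ i))               ≡⟨ sumBelow-reverse (suc n) _ ⟩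
  sumBelow (suc n) (λ i → f (n ∸ i) ℤ.* g (n ∸ (n ∸ i)))   ≡⟨ sumBelow-cong (suc n) swap ⟩
  sumBelow (suc n) (λ i → g i ℤ.* f (n ∸ i))               ≡⟨ sym (sumTo≡sumBelow n _) ⟩
  sumTo n (λ i → g i ℤ.* f (n ∸ i))                        ∎
  where
  open ≡-Reasoning
  swap : ∀ i → i < suc n → f (n ∸ i) ℤ.* g (n ∸ (n ∸ i)) ≡ g i ℤ.* f (n ∸ i)
  swap i (s≤s i≤n) rewrite ℕ.m∸[m∸n]≡n i≤n = ℤ.*-comm (f (n ∸ i)) (g i)

geom-∣ : ∀ {a n} → a ∣ n → geom a n ≡ + 1
geom-∣ {a} {n} a∣n with a ∣? n
... | yes _   = refl
... | no  a∤n = ⊥-elim (a∤n a∣n)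

geom-∤ : ∀ {a n} → ¬ a ∣ n → geom a n ≡ + 0
geom-∤ {a} {n} a∤n with a ∣? n
... | yes a∣n = ⊥-elim (a∤n a∣n)
... | no  _   = refl

geom-zero : ∀ a → geom a 0 ≡ + 1
geom-zero a = geom-∣ (divides 0 refl)

geom-periodic : ∀ a k → geom a (k + a) ≡ geom a k
geom-periodic a k with a ∣? k
... | yes a∣k = geom-∣ (∣m∣n⇒∣m+n a∣k ∣-refl)
... | no  a∤k = geom-∤ (λ a∣k+a → a∤k (∣m+n∣m⇒∣n (subst (a ∣_) (ℕ.+-comm k a) a∣k+a) ∣-refl))

geom-inside : ∀ {a k} → 0 < k → k < a → geom a k ≡ + 0
geom-inside 0<k k<a = geom-∤ (λ a∣k → ℕ.<⇒≱ k<a (∣⇒≤ ⦃ ℕ.>-nonZero 0<k ⦄ a∣k))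

⊛-geom-< : ∀ f {a n} → n < a → (f ⊛ geom a) n ≡ f n
⊛-geom-< f {a} {n} n<a = begin
  sumTo n g                 ≡⟨ sumTo≡sumBelow n g ⟩
  sumBelow (suc n) g        ≡⟨ sumBelow-last n vanish ⟩
  f n ℤ.* geom a (n ∸ n)    ≡⟨ cong (λ k → f n ℤ.* geom a k) (ℕ.n∸n≡0 n) ⟩
  f n ℤ.* geom a 0          ≡⟨ cong (f n ℤ.*_) (geom-zero a) ⟩
  f n ℤ.* + 1               ≡⟨ ℤ.*-identityʳ (f n) ⟩
  f n                       ∎
  where
  open ≡-Reasoning
  g : ℕ → ℤ
  g i = f i ℤ.* geom a (n ∸ i)
  vanish : ∀ i → i < n → g i ≡ + 0
  vanish i i<n = trans
    (cong (f i ℤ.*_) (geom-inside (ℕ.m<n⇒0<n∸m i<n) (ℕ.≤-<-trans (ℕ.m∸n≤m n i) n<a)))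
    (ℤ.*-zeroʳ (f i))

-- With A = suc a, the terms i ≤ m reproduce (f ⊛ geom A) m by periodicity; of the last A
-- terms only i = m + A survives.
⊛-geom-+ : ∀ f a m → (f ⊛ geom (suc a)) (m + suc a) ≡ f (m + suc a) ℤ.+ (f ⊛ geom (suc a)) m
⊛-geom-+ f a m = begin
  sumTo N g                                                  ≡⟨ sumTo≡sumBelow N g ⟩
  sumBelow (suc m + suc a) g                                 ≡⟨ sumBelow-+ (suc m) (suc a) g ⟩
  sumBelow (suc m) g ℤ.+ sumBelow (suc a) (λ t → g (suc m + t)) ≡⟨ cong₂ ℤ._+_ below above ⟩
  (f ⊛ geom A) m ℤ.+ f N                                     ≡⟨ ℤ.+-comm _ (f N) ⟩
  f N ℤ.+ (f ⊛ geom A) m                                     ∎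
  where
  open ≡-Reasoning
  A N : ℕ
  A = suc a
  N = m + A
  g : ℕ → ℤ
  g i = f i ℤ.* geom A (N ∸ i)
  below : sumBelow (suc m) g ≡ (f ⊛ geom A) m
  below = trans (sumBelow-cong (suc m) shift) (sym (sumTo≡sumBelow m _))
    where
    shift : ∀ i → i < suc m → g i ≡ f i ℤ.* geom A (m ∸ i)
    shift i (s≤s i≤m) rewrite ℕ.+-∸-comm A i≤m = cong (f i ℤ.*_) (geom-periodic A (m ∸ i))
  above : sumBelow (suc a) (λ t → g (suc m + t)) ≡ f N
  above = begin
    sumBelow (suc a) (λ t → g (suc m + t)) ≡⟨ sumBelow-last a vanish ⟩
    g (suc m + a)                          ≡⟨ cong g (sym (ℕ.+-suc m a)) ⟩
    f N ℤ.* geom A (N ∸ N)                 ≡⟨ cong (λ k → f N ℤ.* geom A k) (ℕ.n∸n≡0 N) ⟩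
    f N ℤ.* geom A 0                       ≡⟨ cong (f N ℤ.*_) (geom-zero A) ⟩
    f N ℤ.* + 1                            ≡⟨ ℤ.*-identityʳ (f N) ⟩
    f N                                    ∎
    where
    gap : ∀ t → N ∸ (suc m + t) ≡ a ∸ t
    gap t = trans (cong (N ∸_) (sym (ℕ.+-suc m t))) (ℕ.[m+n]∸[m+o]≡n∸o m A (suc t))
    vanish : ∀ t → t < a → g (suc m + t) ≡ + 0
    vanish t t<a rewrite gap t = trans
      (cong (f (suc m + t) ℤ.*_) (geom-inside (ℕ.m<n⇒0<n∸m t<a) (s≤s (ℕ.m∸n≤m a t))))
      (ℤ.*-zeroʳ (f (suc m + t)))

⊛-geom-≥ : ∀ f {a n} → 0 < a → a ≤ n → (f ⊛ geom a) n ≡ f n ℤ.+ (f ⊛ geom a) (n ∸ a)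
⊛-geom-≥ f {suc a} {n} _ a≤n =
  subst (λ k → (f ⊛ geom (suc a)) k ≡ f k ℤ.+ (f ⊛ geom (suc a)) (n ∸ suc a))
        (ℕ.m∸n+n≡m a≤n) (⊛-geom-+ f a (n ∸ suc a))

length-filter-all-but-one : ∀ {A : Set} {P : A → Set} (P? : Decidable P) {xs : List A} {y} →
  Unique xs → y ∈ xs → ¬ P y → (∀ {x} → x ∈ xs → ¬ P x → x ≡ y) →
  suc (length (filter P? xs)) ≡ length xs
length-filter-all-but-one {P = P} P? {y ∷ xs} (y∉xs ∷ _) (here refl) ¬Py only =
  cong (suc ∘ length) (trans (filter-reject P? ¬Py) (filter-all P? all-P))
  where
  all-P : All P xs
  all-P = All.tabulate λ {x} x∈ →
    decidable-stable (P? x) (λ ¬Px → All.lookup y∉xs x∈ (sym (only (there x∈) ¬Px)))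
length-filter-all-but-one P? {x ∷ xs} (x∉xs ∷ u) (there y∈) ¬Py only =
  trans (cong (suc ∘ length) (filter-accept P? Px))
        (cong suc (length-filter-all-but-one P? u y∈ ¬Py (λ x∈ → only (there x∈))))
  where
  Px = decidable-stable (P? x) (λ ¬Px → All.lookup x∉xs y∈ (only (here refl) ¬Px))

Partition : List ℕ → Set
Partition ν = Linked _≥_ ν × All (1 ≤_) ν

linked-∷ : ∀ {x xs} → All (_≤ x) xs → Linked _≥_ xs → Linked _≥_ (x ∷ xs)
linked-∷ []      []  = [-]
linked-∷ (y≤x ∷ _) ys = y≤x ∷ ys

linked⇒≤head : ∀ {x xs} → Linked _≥_ (x ∷ xs) → All (_≤ x) xs
linked⇒≤head [-]       = []
linked⇒≤head (x≥y ∷ l) = Linked.Linked⇒All (λ x≥y y≥z → ℕ.≤-trans y≥z x≥y) x≥y l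

parts≤sum : ∀ xs → All (_≤ sum xs) xs
parts≤sum []       = []
parts≤sum (x ∷ xs) =
  ℕ.m≤m+n x (sum xs) ∷ All.map (λ y≤ → ℕ.≤-trans y≤ (ℕ.m≤n+m (sum xs) x)) (parts≤sum xs)

positive-≤0 : ∀ {ν} → All (1 ≤_) ν → All (_≤ 0) ν → ν ≡ []
positive-≤0 []          []          = refl
positive-≤0 (1≤x ∷ _)   (x≤0 ∷ _)   = ⊥-elim (ℕ.<⇒≱ 1≤x x≤0)

manyParts⇒parts<sum : ∀ {xs} → All (1 ≤_) xs → 2 ≤ length xs → All (_< sum xs) xs
manyParts⇒parts<sum {_ ∷ []} _ (s≤s ())
manyParts⇒parts<sum {x ∷ y ∷ ys} (1≤x ∷ 1≤y ∷ _) _ =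
  ℕ.m<m+n x (ℕ.<-≤-trans 1≤y (ℕ.m≤m+n y (sum ys))) ∷
  All.map (λ z≤ → ℕ.<-≤-trans (s≤s z≤) (ℕ.+-monoˡ-≤ (sum (y ∷ ys)) 1≤x)) (parts≤sum (y ∷ ys))

parts<sum⇒manyParts : ∀ {xs} → 0 < sum xs → All (_< sum xs) xs → 2 ≤ length xs
parts<sum⇒manyParts {x ∷ []}    _ (x<x+0 ∷ []) = ⊥-elim (ℕ.<-irrefl (sym (ℕ.+-identityʳ x)) x<x+0)
parts<sum⇒manyParts {_ ∷ _ ∷ _} _ _            = s≤s (s≤s z≤n)

IsPartition-∷-largest : ∀ {r xs} → IsPartition r xs → 2 ≤ length xs →
                        IsPartition (r + r) (r ∷ xs) × All (_< r) xs
IsPartition-∷-largest {xs = _ ∷ []}     _                          (s≤s ())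
IsPartition-∷-largest {xs = x ∷ y ∷ ys} (l , pos@(1≤x ∷ _) , refl) 2≤len =
  (linked-∷ (parts≤sum (x ∷ y ∷ ys)) l , ℕ.≤-trans 1≤x (ℕ.m≤m+n x _) ∷ pos , refl) ,
  manyParts⇒parts<sum pos 2≤len

onePart : ℕ → List ℕ
onePart zero    = []
onePart (suc k) = [ suc k ]

onePart-length : ∀ r → length (onePart r) ≤ 1
onePart-length zero    = z≤n
onePart-length (suc k) = s≤s z≤n

fewParts⇒onePart : ∀ {xs} → All (1 ≤_) xs → length xs < 2 → xs ≡ onePart (sum xs)
fewParts⇒onePart {[]}         []        _              = refl
fewParts⇒onePart {zero ∷ []}  (() ∷ []) _
fewParts⇒onePart {suc k ∷ []} _         _              = cong (λ m → [ suc m ]) (sym (ℕ.+-identityʳ k))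
fewParts⇒onePart {_ ∷ _ ∷ _}  _         (s≤s (s≤s ()))

-- Partitions into multiples of d

geomProduct : ℕ → ℕ → Series
geomProduct d k = prodTo k (λ j → geom (d * j))

module _ (d : ℕ) .{{_ : NonZero d}} where

  ScaledPartition : ℕ → ℕ → List ℕ → Set
  ScaledPartition k n ν = Partition ν × All (_≤ k) ν × d * sum ν ≡ n

  -- The first argument is fuel; any value exceeding n suffices.
  scaledPartitions : ℕ → ℕ → ℕ → List (List ℕ)
  scaledPartitions zero    k       n       = []
  scaledPartitions (suc f) zero    zero    = [ [] ]
  scaledPartitions (suc f) zero    (suc n) = []
  scaledPartitions (suc f) (suc k) n with d * suc k ≤? n
  ... | yes _ = scaledPartitions (suc f) k n
                ++ map (suc k ∷_) (scaledPartitions f (suc k) (n ∸ d * suc k))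
  ... | no  _ = scaledPartitions (suc f) k n

  private
    part>0 : ∀ k → 0 < d * suc k
    part>0 k = ℕ.>-nonZero⁻¹ (d * suc k) ⦃ ℕ.m*n≢0 d (suc k) ⦄

    fuel-∸ : ∀ {f k n} → n < suc f → d * suc k ≤ n → n ∸ d * suc k < f
    fuel-∸ {k = k} {n} n<1+f p =
      ℕ.<-≤-trans (ℕ.∸-monoʳ-< {n} {d * suc k} {0} (part>0 k) p) (ℕ.≤-pred n<1+f)

  scaledPartitions-length : ∀ f k n → n < f → + length (scaledPartitions f k n) ≡ geomProduct d k n
  scaledPartitions-length (suc f) zero    zero    _ = refl
  scaledPartitions-length (suc f) zero    (suc n) _ = refl
  scaledPartitions-length (suc f) (suc k) n n<f with d * suc k ≤? n
  ... | no  p≰n = trans (scaledPartitions-length (suc f) k n n<f)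
                        (sym (⊛-geom-< (geomProduct d k) (ℕ.≰⇒> p≰n)))
  ... | yes p≤n = begin
    + length (lower ++ map (suc k ∷_) upper)
      ≡⟨ cong +_ (trans (length-++ lower)
                        (cong (_+_ (length lower)) (length-map (suc k ∷_) upper))) ⟩
    + (length lower + length upper)
      ≡⟨ ℤ.pos-+ (length lower) (length upper) ⟩
    + length lower ℤ.+ + length upper
      ≡⟨ cong₂ ℤ._+_ (scaledPartitions-length (suc f) k n n<f)
                     (scaledPartitions-length f (suc k) (n ∸ d * suc k) (fuel-∸ n<f p≤n)) ⟩
    geomProduct d k n ℤ.+ geomProduct d (suc k) (n ∸ d * suc k)
      ≡⟨ sym (⊛-geom-≥ (geomProduct d k) (part>0 k) p≤n) ⟩
    geomProduct d (suc k) n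
      ∎
    where
    open ≡-Reasoning
    lower = scaledPartitions (suc f) k n
    upper = scaledPartitions f (suc k) (n ∸ d * suc k)

  ScaledPartition-suc : ∀ {k n ν} → ScaledPartition k n ν → ScaledPartition (suc k) n ν
  ScaledPartition-suc (p , ≤k , s) = p , All.map ℕ.m≤n⇒m≤1+n ≤k , s

  ∈-scaledPartitions⁻ : ∀ f k n {ν} → n < f → ν ∈ scaledPartitions f k n → ScaledPartition k n ν
  ∈-scaledPartitions⁻ (suc f) zero zero _ (here refl) = ([] , []) , [] , ℕ.*-zeroʳ d
  ∈-scaledPartitions⁻ (suc f) (suc k) n n<f ν∈ with d * suc k ≤? n
  ... | no  _ = ScaledPartition-suc (∈-scaledPartitions⁻ (suc f) k n n<f ν∈)
  ... | yes p≤n with ∈-++⁻ (scaledPartitions (suc f) k n) ν∈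
  ...   | inj₁ ν∈lower = ScaledPartition-suc (∈-scaledPartitions⁻ (suc f) k n n<f ν∈lower)
  ...   | inj₂ ν∈upper with ∈-map⁻ (suc k ∷_) ν∈upper
  ...     | ν' , ν'∈ , refl =
    let ((l , pos) , ≤k+1 , s) = ∈-scaledPartitions⁻ f (suc k) (n ∸ d * suc k) (fuel-∸ n<f p≤n) ν'∈
    in (linked-∷ ≤k+1 l , s≤s z≤n ∷ pos) , ℕ.≤-refl ∷ ≤k+1 ,
       trans (ℕ.*-distribˡ-+ d (suc k) (sum ν'))
             (trans (cong (_+_ (d * suc k)) s) (ℕ.m+[n∸m]≡n p≤n))

  private
    top-or-below : ∀ {k ν} → Linked _≥_ ν → All (_≤ suc k) ν →
                   All (_≤ k) ν ⊎ ∃ λ ν' → ν ≡ suc k ∷ ν'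
    top-or-below []                      []         = inj₁ []
    top-or-below {ν = v ∷ ν'} l (v≤k+1 ∷ _) with ℕ.m≤n⇒m<n∨m≡n v≤k+1
    ... | inj₁ (s≤s v≤k) = inj₁ (v≤k ∷ All.map (λ y≤v → ℕ.≤-trans y≤v v≤k) (linked⇒≤head l))
    ... | inj₂ refl      = inj₂ (ν' , refl)

  ∈-scaledPartitions⁺ : ∀ f k n {ν} → n < f → ScaledPartition k n ν → ν ∈ scaledPartitions f k n
  ∈-scaledPartitions⁺ (suc f) zero n _ ((_ , pos) , ≤0 , s) with positive-≤0 pos ≤0
  ... | refl with trans (sym s) (ℕ.*-zeroʳ d)
  ...   | refl = here refl
  ∈-scaledPartitions⁺ (suc f) (suc k) n n<f ((l , pos) , ≤k+1 , s)
    with d * suc k ≤? n | top-or-below l ≤k+1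
  ... | yes _   | inj₁ ≤k = ∈-++⁺ˡ (∈-scaledPartitions⁺ (suc f) k n n<f ((l , pos) , ≤k , s))
  ... | no  _   | inj₁ ≤k = ∈-scaledPartitions⁺ (suc f) k n n<f ((l , pos) , ≤k , s)
  ... | yes p≤n | inj₂ (ν' , refl) =
    ∈-++⁺ʳ (scaledPartitions (suc f) k n) (∈-map⁺ (suc k ∷_)
      (∈-scaledPartitions⁺ f (suc k) (n ∸ d * suc k) (fuel-∸ n<f p≤n)
        ((Linked.tail l , All.tail pos) , All.tail ≤k+1 , rest-sum)))
    where
    rest-sum : d * sum ν' ≡ n ∸ d * suc k
    rest-sum = sym (begin
      n ∸ d * suc k                      ≡⟨ cong (_∸ d * suc k) (sym s) ⟩
      d * (suc k + sum ν') ∸ d * suc k   ≡⟨ cong (_∸ d * suc k) (ℕ.*-distribˡ-+ d (suc k) (sum ν')) ⟩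
      d * suc k + d * sum ν' ∸ d * suc k ≡⟨ ℕ.m+n∸m≡n (d * suc k) (d * sum ν') ⟩
      d * sum ν'                         ∎)
      where open ≡-Reasoning
  ... | no  p≰n | inj₂ (ν' , refl) =
    ⊥-elim (p≰n (subst (d * suc k ≤_) s (ℕ.*-monoʳ-≤ d (ℕ.m≤m+n (suc k) (sum ν')))))

  scaledPartitions-unique : ∀ f k n → n < f → Unique (scaledPartitions f k n)
  scaledPartitions-unique (suc f) zero    zero    _ = [] ∷ []
  scaledPartitions-unique (suc f) zero    (suc n) _ = []
  scaledPartitions-unique (suc f) (suc k) n n<f with d * suc k ≤? n
  ... | no  _   = scaledPartitions-unique (suc f) k n n<f
  ... | yes p≤n = Unique.++⁺ (scaledPartitions-unique (suc f) k n n<f)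
    (Unique.map⁺ ∷-injectiveʳ (scaledPartitions-unique f (suc k) _ (fuel-∸ n<f p≤n)))
    disjoint
    where
    disjoint : ∀ {ν} → ¬ (ν ∈ scaledPartitions (suc f) k n × ν ∈ map (suc k ∷_) _)
    disjoint (ν∈lower , ν∈upper) with ∈-map⁻ (suc k ∷_) ν∈upper
    ... | _ , _ , refl with ∈-scaledPartitions⁻ (suc f) k n n<f ν∈lower
    ...   | _ , k+1≤k ∷ _ , _ = ℕ.<-irrefl refl k+1≤k

-- Unlike 2 ∣? _, this parity test computes on open terms such as suc (h + h).
isOdd : ℕ → Bool
isOdd zero          = false
isOdd (suc zero)    = true
isOdd (suc (suc n)) = isOdd n

isOdd-double : ∀ h → isOdd (h + h) ≡ false
isOdd-double zero    = refl
isOdd-double (suc h) rewrite ℕ.+-suc h h = isOdd-double h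

isOdd-suc-double : ∀ h → isOdd (suc (h + h)) ≡ true
isOdd-suc-double zero    = refl
isOdd-suc-double (suc h) rewrite ℕ.+-suc h h = isOdd-suc-double h

⌊suc-double/2⌋ : ∀ h → ⌊ suc (h + h) /2⌋ ≡ h
⌊suc-double/2⌋ zero    = refl
⌊suc-double/2⌋ (suc h) rewrite ℕ.+-suc h h = cong suc (⌊suc-double/2⌋ h)

data Parity : ℕ → Set where
  even : ∀ h → Parity (h + h)
  odd  : ∀ h → Parity (suc (h + h))

parity : ∀ n → Parity n
parity zero    = even 0
parity (suc n) with parity n
... | even h = odd h
... | odd  h = subst Parity (cong suc (ℕ.+-suc h h)) (even (suc h))

even-double : ∀ h → Even (h + h)
even-double h = divides h (trans (cong (_+_ h) (sym (ℕ.+-identityʳ h))) (ℕ.*-comm 2 h))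

odd-suc-double : ∀ h → Odd (suc (h + h))
odd-suc-double h 2∣ with ∣1⇒≡1 (∣m+n∣m⇒∣n (subst (2 ∣_) (ℕ.+-comm 1 (h + h)) 2∣) (even-double h))
... | ()

double-injective : ∀ {m n} → m + m ≡ n + n → m ≡ n
double-injective {m} {n} eq = trans (ℕ.n≡⌊n+n/2⌋ m) (trans (cong ⌊_/2⌋ eq) (sym (ℕ.n≡⌊n+n/2⌋ n)))

-- Partitions with even parts below odd parts, and their codes

ebo-∷ : ∀ {x xs} → All (_≤ x) xs → (Even x → All Even xs) →
        EvensBelowOdds xs → EvensBelowOdds (x ∷ xs)
ebo-∷ ≤x evens ebo (here refl) (here refl)  ex oy = ⊥-elim (oy ex)
ebo-∷ ≤x evens ebo (here refl) (there y∈)   ex oy = ⊥-elim (oy (All.lookup (evens ex) y∈))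
ebo-∷ ≤x evens ebo (there x∈)  (here refl)  ex oy =
  ℕ.≤∧≢⇒< (All.lookup ≤x x∈) (λ x≡y → oy (subst Even x≡y ex))
ebo-∷ ≤x evens ebo (there x∈)  (there y∈)   ex oy = ebo x∈ y∈ ex oy

ebo-tail : ∀ {x xs} → EvensBelowOdds (x ∷ xs) → EvensBelowOdds xs
ebo-tail ebo x∈ y∈ = ebo (there x∈) (there y∈)

ebo-even-head : ∀ {x xs} → All (_≤ x) xs → EvensBelowOdds (x ∷ xs) → Even x → All Even xs
ebo-even-head ≤x ebo ex = All.tabulate λ y∈ →
  decidable-stable (2 ∣? _) (λ oy → ℕ.<⇒≱ (ebo (here refl) (there y∈) ex oy) (All.lookup ≤x y∈))

onePart-partition : ∀ r → IsPartition r (onePart r) × EvensBelowOdds (onePart r)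
onePart-partition zero    = ([] , [] , refl) , λ ()
onePart-partition (suc k) =
  ([-] , s≤s z≤n ∷ [] , ℕ.+-identityʳ (suc k)) , ebo-∷ [] (λ _ → []) (λ ())

Code : Set
Code = ℕ × List ℕ

weight : Code → ℕ
weight (b , ν) = b + (sum ν + sum ν)

decode : Code → List ℕ
decode (zero  , ν)     = map (λ v → v + v) ν
decode (suc b , [])    = 1 ∷ decode (b , [])
decode (suc b , v ∷ ν) = suc (v + v) ∷ decode (b , ν)

oddCount : List ℕ → ℕ
oddCount []       = 0
oddCount (x ∷ xs) = if isOdd x then suc (oddCount xs) else oddCount xs

halves : List ℕ → List ℕ
halves xs = filter (1 ≤?_) (map ⌊_/2⌋ xs)

encode : List ℕ → Code
encode xs = oddCount xs , halves xs

encode-∷-odd : ∀ h xs →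
  encode (suc (h + h) ∷ xs) ≡ (suc (oddCount xs) , filter (1 ≤?_) (h ∷ map ⌊_/2⌋ xs))
encode-∷-odd h xs rewrite isOdd-suc-double h | ⌊suc-double/2⌋ h = refl

encode-∷-even : ∀ h xs →
  encode (h + h ∷ xs) ≡ (oddCount xs , filter (1 ≤?_) (h ∷ map ⌊_/2⌋ xs))
encode-∷-even h xs rewrite isOdd-double h | sym (ℕ.n≡⌊n+n/2⌋ h) = refl

decode-sum : ∀ c → sum (decode c) ≡ weight c
decode-sum (zero  , [])    = refl
decode-sum (zero  , v ∷ ν) =
  trans (cong (_+_ (v + v)) (decode-sum (0 , ν))) (lemma v (sum ν))
  where
  lemma : ∀ v s → (v + v) + (s + s) ≡ (v + s) + (v + s)
  lemma = solve-∀
decode-sum (suc b , [])    = cong suc (decode-sum (b , []))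
decode-sum (suc b , v ∷ ν) =
  trans (cong (_+_ (suc (v + v))) (decode-sum (b , ν))) (lemma v b (sum ν))
  where
  lemma : ∀ v b s → suc (v + v) + (b + (s + s)) ≡ suc b + ((v + s) + (v + s))
  lemma = solve-∀

decode-positive : ∀ c → All (1 ≤_) (proj₂ c) → All (1 ≤_) (decode c)
decode-positive (zero  , [])    []          = []
decode-positive (zero  , v ∷ ν) (1≤v ∷ pos) =
  ℕ.≤-trans 1≤v (ℕ.m≤m+n v v) ∷ decode-positive (0 , ν) pos
decode-positive (suc b , [])    []          = s≤s z≤n ∷ decode-positive (b , []) []
decode-positive (suc b , v ∷ ν) (_ ∷ pos)   = s≤s z≤n ∷ decode-positive (b , ν) pos

private
  double-mono : ∀ {u v} → u ≤ v → u + u ≤ v + v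
  double-mono u≤v = ℕ.+-mono-≤ u≤v u≤v

decode-bounded : ∀ {v} c → All (_≤ v) (proj₂ c) → All (_≤ suc (v + v)) (decode c)
decode-bounded     (zero  , [])    []         = []
decode-bounded {v} (zero  , u ∷ ν) (u≤v ∷ ≤v) =
  ℕ.m≤n⇒m≤1+n (double-mono u≤v) ∷ decode-bounded {v} (0 , ν) ≤v
decode-bounded {v} (suc b , [])    []         = s≤s z≤n ∷ decode-bounded {v} (b , []) []
decode-bounded {v} (suc b , u ∷ ν) (u≤v ∷ ≤v) =
  s≤s (double-mono u≤v) ∷ decode-bounded {v} (b , ν) ≤v

decode-linked : ∀ c → Linked _≥_ (proj₂ c) → Linked _≥_ (decode c)
decode-linked (zero  , ν)     l = Linked.map⁺ (Linked.map double-mono l)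
decode-linked (suc b , [])    l =
  linked-∷ (decode-bounded {0} (b , []) []) (decode-linked (b , []) [])
decode-linked (suc b , v ∷ ν) l =
  linked-∷ (decode-bounded {v} (b , ν) (linked⇒≤head l)) (decode-linked (b , ν) (Linked.tail l))

decode-ebo : ∀ c → Linked _≥_ (proj₂ c) → EvensBelowOdds (decode c)
decode-ebo (zero  , ν)     _ x∈ y∈ _ oy = ⊥-elim (oy (All.lookup (evens ν) y∈))
  where
  evens : ∀ ν → All Even (decode (0 , ν))
  evens []      = []
  evens (v ∷ ν) = even-double v ∷ evens ν
decode-ebo (suc b , [])    l =
  ebo-∷ (decode-bounded {0} (b , []) []) (λ e → ⊥-elim (odd-suc-double 0 e))
        (decode-ebo (b , []) [])
decode-ebo (suc b , v ∷ ν) l =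
  ebo-∷ (decode-bounded {v} (b , ν) (linked⇒≤head l)) (λ e → ⊥-elim (odd-suc-double v e))
        (decode-ebo (b , ν) (Linked.tail l))

encode-decode : ∀ c → All (1 ≤_) (proj₂ c) → encode (decode c) ≡ c
encode-decode (zero  , [])        []        = refl
encode-decode (zero  , suc v ∷ ν) (_ ∷ pos) =
  trans (encode-∷-even (suc v) (decode (0 , ν)))
        (cong (λ c → proj₁ c , suc v ∷ proj₂ c) (encode-decode (0 , ν) pos))
encode-decode (suc b , [])        []        =
  cong (λ c → suc (proj₁ c) , proj₂ c) (encode-decode (b , []) [])
encode-decode (suc b , suc v ∷ ν) (_ ∷ pos) =
  trans (encode-∷-odd (suc v) (decode (b , ν)))
        (cong (λ c → suc (proj₁ c) , suc v ∷ proj₂ c) (encode-decode (b , ν) pos))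

encode-partition : ∀ {xs} → Linked _≥_ xs → Partition (proj₂ (encode xs))
encode-partition {xs} l =
  Linked.filter⁺ (1 ≤?_) (λ x≥y y≥z → ℕ.≤-trans y≥z x≥y) (Linked.map⁺ (Linked.map ℕ.⌊n/2⌋-mono l)) ,
  all-filter (1 ≤?_) (map ⌊_/2⌋ xs)

oddCount-evens : ∀ {xs} → All Even xs → oddCount xs ≡ 0
oddCount-evens []                     = refl
oddCount-evens {x ∷ xs} (ex ∷ evens) with parity x
... | even h rewrite isOdd-double h = oddCount-evens evens
... | odd  h = ⊥-elim (odd-suc-double h ex)

halves-≤1 : ∀ {xs} → All (_≤ 1) xs → halves xs ≡ []
halves-≤1 []             = refl
halves-≤1 (z≤n ∷ ≤1)     = halves-≤1 ≤1
halves-≤1 (s≤s z≤n ∷ ≤1) = halves-≤1 ≤1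

decode-encode : ∀ {xs} → Partition xs → EvensBelowOdds xs → decode (encode xs) ≡ xs
decode-encode {[]}     _               _   = refl
decode-encode {x ∷ xs} (l , 1≤x ∷ pos) ebo
  with parity x | decode-encode (Linked.tail l , pos) (ebo-tail ebo)
... | even zero    | _  = ⊥-elim (ℕ.<-irrefl refl 1≤x)
... | even (suc h) | IH = begin
  decode (encode (suc h + suc h ∷ xs))
    ≡⟨ cong decode (encode-∷-even (suc h) xs) ⟩
  decode (oddCount xs , suc h ∷ halves xs)
    ≡⟨ cong (λ b → decode (b , suc h ∷ halves xs)) no-odds ⟩
  suc h + suc h ∷ decode (0 , halves xs)
    ≡⟨ cong (λ b → suc h + suc h ∷ decode (b , halves xs)) (sym no-odds) ⟩
  suc h + suc h ∷ decode (encode xs)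
    ≡⟨ cong (suc h + suc h ∷_) IH ⟩
  suc h + suc h ∷ xs
    ∎
  where
  open ≡-Reasoning
  no-odds : oddCount xs ≡ 0
  no-odds = oddCount-evens (ebo-even-head (linked⇒≤head l) ebo (even-double (suc h)))
... | odd zero     | IH = begin
  decode (suc (oddCount xs) , halves xs) ≡⟨ cong (λ ν → decode (suc (oddCount xs) , ν)) no-halves ⟩
  1 ∷ decode (oddCount xs , [])          ≡⟨ cong (λ ν → 1 ∷ decode (oddCount xs , ν)) (sym no-halves) ⟩
  1 ∷ decode (encode xs)                 ≡⟨ cong (1 ∷_) IH ⟩
  1 ∷ xs                                 ∎
  where
  open ≡-Reasoning
  no-halves : halves xs ≡ []
  no-halves = halves-≤1 (linked⇒≤head l)
... | odd (suc h)  | IH =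
  trans (cong decode (encode-∷-odd (suc h) xs)) (cong (suc (suc h + suc h) ∷_) IH)

-- Enumerating codes

IsCode : ℕ → Code → Set
IsCode n c = Partition (proj₂ c) × weight c + weight c ≡ n

-- A partition of n/4 has parts at most n, so the bound n and the fuel suc n lose nothing.
evenCodes : ℕ → List Code
evenCodes n = map (0 ,_) (scaledPartitions 4 (suc n) n n)

withOdd : Code → Code
withOdd (b , ν) = suc b , ν

codes : ℕ → List Code
codes zero          = evenCodes 0
codes (suc zero)    = evenCodes 1
codes (suc (suc n)) = evenCodes (suc (suc n)) ++ map withOdd (codes n)

private
  quadruple : ∀ s → (s + s) + (s + s) ≡ 4 * s
  quadruple = solve-∀

  suc-double : ∀ w → suc w + suc w ≡ suc (suc (w + w))
  suc-double w = cong suc (ℕ.+-suc w w)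

∈-evenCodes⁻ : ∀ n {c} → c ∈ evenCodes n → IsCode n c
∈-evenCodes⁻ n c∈ with ∈-map⁻ (0 ,_) c∈
... | ν , ν∈ , refl with ∈-scaledPartitions⁻ 4 (suc n) n n ℕ.≤-refl ν∈
...   | p , _ , s = p , trans (quadruple (sum ν)) s

∈-evenCodes⁺ : ∀ n {ν} → IsCode n (0 , ν) → (0 , ν) ∈ evenCodes n
∈-evenCodes⁺ n {ν} (p , e) =
  ∈-map⁺ (0 ,_) (∈-scaledPartitions⁺ 4 (suc n) n n ℕ.≤-refl (p , ≤n , 4s≡n))
  where
  4s≡n : 4 * sum ν ≡ n
  4s≡n = trans (sym (quadruple (sum ν))) e
  ≤n : All (_≤ n) ν
  ≤n = All.map (λ ≤s → ℕ.≤-trans ≤s (subst (sum ν ≤_) 4s≡n (ℕ.m≤n*m (sum ν) 4))) (parts≤sum ν)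

∈-codes⁻ : ∀ n {c} → c ∈ codes n → IsCode n c
∈-codes⁻ zero          c∈ = ∈-evenCodes⁻ 0 c∈
∈-codes⁻ (suc zero)    c∈ = ∈-evenCodes⁻ 1 c∈
∈-codes⁻ (suc (suc n)) c∈ with ∈-++⁻ (evenCodes (suc (suc n))) c∈
... | inj₁ c∈even = ∈-evenCodes⁻ _ c∈even
... | inj₂ c∈odd with ∈-map⁻ withOdd c∈odd
...   | (b , ν) , c'∈ , refl with ∈-codes⁻ n c'∈
...     | p , e = p , trans (suc-double (weight (b , ν))) (cong (λ m → suc (suc m)) e)

∈-codes⁺ : ∀ {n} c → IsCode n c → c ∈ codes n
∈-codes⁺ (b , ν) = go b
  where
  go : ∀ {n} b → IsCode n (b , ν) → (b , ν) ∈ codes n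
  go {zero}        zero    isCode = ∈-evenCodes⁺ 0 isCode
  go {suc zero}    zero    isCode = ∈-evenCodes⁺ 1 isCode
  go {suc (suc n)} zero    isCode = ∈-++⁺ˡ (∈-evenCodes⁺ (suc (suc n)) isCode)
  go               (suc b) (p , e) with trans (sym (suc-double (weight (b , ν)))) e
  ... | refl = ∈-++⁺ʳ (evenCodes (2 + (w + w))) (∈-map⁺ withOdd (go b (p , refl)))
    where w = weight (b , ν)

evenCodes-unique : ∀ n → Unique (evenCodes n)
evenCodes-unique n =
  Unique.map⁺ {f = 0 ,_} (cong proj₂) (scaledPartitions-unique 4 (suc n) n n ℕ.≤-refl)

codes-unique : ∀ n → Unique (codes n)
codes-unique zero          = evenCodes-unique 0
codes-unique (suc zero)    = evenCodes-unique 1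
codes-unique (suc (suc n)) =
  Unique.++⁺ (evenCodes-unique (suc (suc n)))
             (Unique.map⁺ withOdd-injective (codes-unique n))
             disjoint
  where
  withOdd-injective : ∀ {c c'} → withOdd c ≡ withOdd c' → c ≡ c'
  withOdd-injective {_ , _} {_ , _} refl = refl
  disjoint : ∀ {c} → ¬ (c ∈ evenCodes (suc (suc n)) × c ∈ map withOdd (codes n))
  disjoint (c∈even , c∈odd) with ∈-map⁻ (0 ,_) c∈even | ∈-map⁻ withOdd c∈odd
  ... | _ , _ , refl | (_ , _) , _ , ()

codes-odd : ∀ h → codes (suc (h + h)) ≡ []
codes-odd h with codes (suc (h + h)) | ∈-codes⁻ (suc (h + h))
... | []    | _       = refl
... | c ∷ _ | ∈codes⁻ =
  ⊥-elim (odd-suc-double h (subst Even (proj₂ (∈codes⁻ (here refl))) (even-double (weight c))))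

rhs-step : ∀ n → rhs (suc (suc n)) ≡ (invQ4Q4 ⊝ one) (suc (suc n)) ℤ.+ rhs n
rhs-step n = begin
  (geom 2 ⊛ h) (2 + n)           ≡⟨ ⊛-comm (geom 2) h (2 + n) ⟩
  (h ⊛ geom 2) (2 + n)           ≡⟨ ⊛-geom-≥ h {2} {2 + n} (s≤s z≤n) (s≤s (s≤s z≤n)) ⟩
  h (2 + n) ℤ.+ (h ⊛ geom 2) n   ≡⟨ cong (ℤ._+_ (h (2 + n))) (⊛-comm h (geom 2) n) ⟩
  h (2 + n) ℤ.+ (geom 2 ⊛ h) n   ∎
  where
  open ≡-Reasoning
  h = invQ4Q4 ⊝ one

codes-length : ∀ n → + length (codes n) ≡ rhs n ℤ.+ geom 2 n
codes-length zero          = refl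
codes-length (suc zero)    = refl
codes-length (suc (suc n)) = begin
  + length (evenCodes N ++ map withOdd (codes n))
    ≡⟨ cong +_ (trans (length-++ (evenCodes N))
                      (cong (_+_ (length (evenCodes N))) (length-map withOdd (codes n)))) ⟩
  + (length (evenCodes N) + length (codes n))
    ≡⟨ ℤ.pos-+ (length (evenCodes N)) (length (codes n)) ⟩
  + length (evenCodes N) ℤ.+ + length (codes n)
    ≡⟨ cong₂ ℤ._+_ evenCodes-length (codes-length n) ⟩
  (invQ4Q4 ⊝ one) N ℤ.+ (rhs n ℤ.+ geom 2 n)
    ≡⟨ sym (ℤ.+-assoc ((invQ4Q4 ⊝ one) N) (rhs n) (geom 2 n)) ⟩
  ((invQ4Q4 ⊝ one) N ℤ.+ rhs n) ℤ.+ geom 2 n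
    ≡⟨ cong₂ ℤ._+_ (sym (rhs-step n))
                   (trans (sym (geom-periodic 2 n)) (cong (geom 2) (ℕ.+-comm n 2))) ⟩
  rhs N ℤ.+ geom 2 N
    ∎
  where
  open ≡-Reasoning
  N = suc (suc n)
  evenCodes-length : + length (evenCodes N) ≡ (invQ4Q4 ⊝ one) N
  evenCodes-length = begin
    + length (evenCodes N)
      ≡⟨ cong +_ (length-map {B = Code} (0 ,_) (scaledPartitions 4 (suc N) N N)) ⟩
    + length (scaledPartitions 4 (suc N) N N)
      ≡⟨ scaledPartitions-length 4 (suc N) N N ℕ.≤-refl ⟩
    invQ4Q4 N
      ≡⟨ sym (ℤ.+-identityʳ (invQ4Q4 N)) ⟩
    (invQ4Q4 ⊝ one) N
      ∎

withLargestPart : Code → List ℕ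
withLargestPart c = weight c ∷ decode c

decode-partition : ∀ c → Partition (proj₂ c) →
                   IsPartition (weight c) (decode c) × EvensBelowOdds (decode c)
decode-partition c (l , pos) =
  (decode-linked c l , decode-positive c pos , decode-sum c) , decode-ebo c l

encode-code : ∀ {r xs} → IsPartition r xs → EvensBelowOdds xs →
              IsCode (r + r) (encode xs) × withLargestPart (encode xs) ≡ r ∷ xs
encode-code {r} {xs} (l , pos , s) ebo =
  (encode-partition l , cong (λ w → w + w) w≡r) , cong₂ _∷_ w≡r d≡
  where
  d≡ : decode (encode xs) ≡ xs
  d≡ = decode-encode (l , pos) ebo
  w≡r : weight (encode xs) ≡ r
  w≡r = trans (sym (decode-sum (encode xs))) (trans (cong sum d≡) s)

-- For a partition rest of r, the list r ∷ rest has at least three entries iff rest has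
-- at least two parts, i.e. iff all parts of rest are smaller than r.
manyParts? : (x : List ℕ) → Dec (3 ≤ length x)
manyParts? x = 3 ≤? length x

rhoPartitions : ℕ → List (List ℕ)
rhoPartitions n = filter manyParts? (map withLargestPart (codes n))

∈-rhoPartitions⁻ : ∀ n {x} → x ∈ rhoPartitions n → RhoPartition n x
∈-rhoPartitions⁻ n x∈ with ∈-filter⁻ manyParts? {xs = map withLargestPart (codes n)} x∈
... | x∈map , many with ∈-map⁻ withLargestPart x∈map
...   | c , c∈ , refl =
  let p , 2w≡n       = ∈-codes⁻ n c∈
      part , ebo      = decode-partition c p
      whole , parts<w = IsPartition-∷-largest part (ℕ.s≤s⁻¹ many)
  in subst (λ m → IsPartition m _) 2w≡n whole , weight c , decode c , refl , parts<w , part , ebo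

∈-rhoPartitions⁺ : ∀ n {x} → RhoPartition n x → x ∈ rhoPartitions n
∈-rhoPartitions⁺ n ((_ , 1≤r ∷ _ , 2r≡n) , r , rest , refl , parts<r , part@(_ , _ , refl) , ebo) =
  let isCode , ≡x = encode-code part ebo
      c∈          = ∈-codes⁺ (encode rest) (subst (λ m → IsCode m (encode rest)) 2r≡n isCode)
  in ∈-filter⁺ manyParts? (subst (_∈ map withLargestPart (codes n)) ≡x (∈-map⁺ withLargestPart c∈))
               (s≤s (parts<sum⇒manyParts 1≤r parts<r))

withLargestPart-unique : ∀ n → Unique (map withLargestPart (codes n))
withLargestPart-unique n =
  Unique.map⁻ {f = encode ∘ drop 1} (subst Unique (sym recovered) (codes-unique n))
  where
  recovered : map (encode ∘ drop 1) (map withLargestPart (codes n)) ≡ codes n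
  recovered = trans (sym (map-∘ (codes n)))
    (map-id-local (All.tabulate λ {c} c∈ → encode-decode c (proj₂ (proj₁ (∈-codes⁻ n c∈)))))

rhoPartitions-unique : ∀ n → Unique (rhoPartitions n)
rhoPartitions-unique n = Unique.filter⁺ manyParts? (withLargestPart-unique n)

onePart-∈ : ∀ r → r ∷ onePart r ∈ map withLargestPart (codes (r + r))
onePart-∈ r =
  let part , ebo  = onePart-partition r
      isCode , ≡y = encode-code part ebo
  in subst (_∈ map withLargestPart (codes (r + r))) ≡y
           (∈-map⁺ withLargestPart (∈-codes⁺ (encode (onePart r)) isCode))

∈-fewParts⇒onePart : ∀ r {x} → x ∈ map withLargestPart (codes (r + r)) → ¬ 3 ≤ length x →
                     x ≡ r ∷ onePart r
∈-fewParts⇒onePart r x∈ ¬many with ∈-map⁻ withLargestPart x∈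
... | c , c∈ , refl =
  let p , 2w≡2r         = ∈-codes⁻ (r + r) c∈
      (_ , pos , s) , _ = decode-partition c p
      w≡r               = double-injective 2w≡2r
  in cong₂ _∷_ w≡r (trans (fewParts⇒onePart pos (ℕ.≤-pred (ℕ.≰⇒> ¬many)))
                          (cong onePart (trans s w≡r)))

rhoPartitions-even : ∀ r → suc (length (rhoPartitions (r + r))) ≡ length (codes (r + r))
rhoPartitions-even r =
  trans (length-filter-all-but-one manyParts? (withLargestPart-unique (r + r)) (onePart-∈ r)
                                   (ℕ.<⇒≱ (s≤s (s≤s (onePart-length r)))) (∈-fewParts⇒onePart r))
        (length-map withLargestPart (codes (r + r)))

rhoPartitions-odd : ∀ r → rhoPartitions (suc (r + r)) ≡ []
rhoPartitions-odd r = cong (filter manyParts? ∘ map withLargestPart) (codes-odd r)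

rhoPartitions-length : ∀ n → + length (rhoPartitions n) ≡ rhs n
rhoPartitions-length n with parity n
... | even r = ∙-cancelʳ (+ 1) _ _ (begin
  + length (rhoPartitions n) ℤ.+ + 1 ≡⟨ sym (ℤ.pos-+ (length (rhoPartitions n)) 1) ⟩
  + (length (rhoPartitions n) + 1)   ≡⟨ cong +_ (ℕ.+-comm (length (rhoPartitions n)) 1) ⟩
  + suc (length (rhoPartitions n))   ≡⟨ cong +_ (rhoPartitions-even r) ⟩
  + length (codes n)                 ≡⟨ codes-length n ⟩
  rhs n ℤ.+ geom 2 n                 ≡⟨ cong (ℤ._+_ (rhs n)) (geom-∣ (even-double r)) ⟩
  rhs n ℤ.+ + 1                      ∎)
  where open ≡-Reasoning
... | odd r = begin
  + length (rhoPartitions n)         ≡⟨ cong (+_ ∘ length) (rhoPartitions-odd r) ⟩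
  + 0                                ≡⟨ cong (+_ ∘ length) (sym (codes-odd r)) ⟩
  + length (codes n)                 ≡⟨ codes-length n ⟩
  rhs n ℤ.+ geom 2 n                 ≡⟨ cong (ℤ._+_ (rhs n)) (geom-∤ (odd-suc-double r)) ⟩
  rhs n ℤ.+ + 0                      ≡⟨ ℤ.+-identityʳ (rhs n) ⟩
  rhs n                              ∎
  where open ≡-Reasoning

theorem1p7 : (n : ℕ) → CountIs (RhoPartition n) (rhs n)
theorem1p7 n =
  rhoPartitions n ,
  rhoPartitions-unique n ,
  (λ x → mk⇔ (∈-rhoPartitions⁻ n) (∈-rhoPartitions⁺ n)) ,
  rhoPartitions-length n
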